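{- Let $p$ be an odd prime with $p^n\equiv 2\pmod 3$, $F$ the finite field of order $p^n$, $L$ its quadratic extension, and $s=1+k(p^n-1)$ (with $k$ an integer) an invertible exponent over $L$, i.e. $\gcd(s,p^{2n}-1)=1$. If $x\in L$ satisfies $x^{3(p^n-1)}=1$, then $\mathrm{Tr}_{L/F}(x^s-x)=0$.
   Context: $\mathrm{Tr}_{L/F}(y)=y+y^{p^n}$ denotes the relative trace from $L$ to $F$. -}

module Defs where

open import Level using (Level; _⊔_; suc)
open import Data.Nat using (ℕ)
import Data.Nat as ℕ
open import Data.Fin using (Fin)
open import Data.Integer using (ℤ; +_; -[1+_])
open import Data.Product using (∃)
open import Relation.Binary.PropositionalEquality using (_≡_)
open import Relation.Nullary using (¬_)
open import Algebra.Bundles using (CommutativeRing)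
import Algebra.Bundles
import Algebra.Definitions.RawSemiring as RS

record FiniteField (c ℓ : Level) (m : ℕ) : Set (Level.suc (c ⊔ ℓ)) where
  field
    commRing : CommutativeRing c ℓ
  open CommutativeRing commRing public
  field
    0≉1      : ¬ (0# ≈ 1#)
    _⁻¹      : Carrier → Carrier
    inverseʳ : ∀ x → ¬ (x ≈ 0#) → (x * (x ⁻¹)) ≈ 1#
    enum     : Fin m → Carrier
    enum-inj : ∀ i j → enum i ≈ enum j → i ≡ j
    enum-sur : ∀ x → ∃ λ i → enum i ≈ x

  _^_ : Carrier → ℕ → Carrier
  _^_ = RS._^_ (Algebra.Bundles.Semiring.rawSemiring semiring)

  _^ℤ_ : Carrier → ℤ → Carrier
  x ^ℤ (+ n)    = x ^ n
  x ^ℤ -[1+ n ] = (x ⁻¹) ^ ℕ.suc n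

-- Relative trace Tr_{L/F}(y) = y + y^{q} for L the quadratic extension of F, |F| = q.
module _ {c ℓ m} (L : FiniteField c ℓ m) where
  open FiniteField L
  Tr : ℕ → Carrier → Carrier
  Tr q y = y + (y ^ q)

{-# OPTIONS --safe #-}
module Submission where

-- Write q = p ^ n = 2 + 3 t and y = x ^ (q − 1). Then y ^ 3 = 1, x ^ q = x y and
-- y ^ q = y ^ 2. Since q ≡ 2 (mod 3), 3 divides q ^ 2 − 1, hence 3 does not divide
-- s = 1 + k (q − 1) ≡ 1 + k (mod 3); so k ≢ 2 (mod 3) and x ^ s is x or x y. In the second, L has characteristic p, so y ↦ y ^ q is
-- additive and Tr (x y − x) = (x y − x) + (x y ^ 3 − x y) = 0.

open import Defs
open import Level using (_⊔_)
open import Algebra.Bundles using (CommutativeRing)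
open import Data.Empty using (⊥-elim)
open import Data.Fin as Fin using (Fin; inject₁; fromℕ)
open import Data.Fin.Properties using (toℕ-fromℕ; inject₁ℕ<)
open import Data.Fin.Permutation using (Permutation; permutation)
import Data.Integer as ℤ
open ℤ using (ℤ; +_; -[1+_]; ∣_∣)
open import Data.Integer using () renaming (_+_ to _+ℤ_; _*_ to _*ℤ_; +_ to ℤ+_)
open import Data.Integer.Properties using (∣-i∣≡∣i∣)
import Data.Nat as ℕ
open ℕ using (ℕ; zero; suc; _<_; _∸_; _%_; _!; s≤s; z≤n)
import Data.Nat.Properties as ℕ
open import Data.Nat.Properties using (_!*_!≢0)
open import Data.Nat.Combinatorics using (_C_; nCk≡n!/k![n-k]!; k![n∸k]!∣n!; nCn≡1)
open import Data.Nat.Divisibility using (_∣_; divides; ∣⇒≤; ∣1⇒≡1; m∣m*n)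
open import Data.Nat.DivMod using (m/n*n≡m; m≡m%n+[m/n]*n)
open import Data.Nat.GCD using (gcd; gcd-greatest)
open import Data.Nat.Primality using (Prime; euclidsLemma; ¬prime[0]; ¬prime[1])
open import Data.Nat.Tactic.RingSolver using (solve-∀)
open import Data.Product using (proj₁; proj₂)
open import Data.Sum using (_⊎_; inj₁; inj₂)
open import Relation.Binary.Definitions using (Decidable)
import Relation.Binary.PropositionalEquality as ≡
open ≡ using (_≡_)
open import Relation.Nullary using (¬_; yes; no)

prime∤! : ∀ {p} → Prime p → ∀ {j} → j < p → ¬ p ∣ j !
prime∤! p-prime {zero}  _   p∣1 = ¬prime[1] (≡.subst Prime (∣1⇒≡1 p∣1) p-prime)
prime∤! p-prime {suc j} j<p p∣[1+j]! with euclidsLemma (suc j) (j !) p-prime p∣[1+j]!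
... | inj₁ p∣1+j = ℕ.<⇒≱ j<p (∣⇒≤ p∣1+j)
... | inj₂ p∣j!  = prime∤! p-prime (ℕ.<-trans (ℕ.n<1+n j) j<p) p∣j!

p∣pCk : ∀ {p k} → Prime p → 0 < k → k < p → p ∣ p C k
p∣pCk {p@(suc p-1)} {k} p-prime 0<k k<p
  with euclidsLemma (p C k) (k ! ℕ.* (p ∸ k) !) p-prime p∣pCk*k![p∸k]!
  where
  instance _ = k !* (p ∸ k) !≢0
  pCk*k![p∸k]!≡p! : (p C k) ℕ.* (k ! ℕ.* (p ∸ k) !) ≡ p !
  pCk*k![p∸k]!≡p! = ≡.trans (≡.cong (ℕ._* (k ! ℕ.* (p ∸ k) !)) (nCk≡n!/k![n-k]! (ℕ.<⇒≤ k<p)))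
                            (m/n*n≡m (k![n∸k]!∣n! (ℕ.<⇒≤ k<p)))
  p∣pCk*k![p∸k]! : p ∣ (p C k) ℕ.* (k ! ℕ.* (p ∸ k) !)
  p∣pCk*k![p∸k]! = ≡.subst (p ∣_) (≡.sym pCk*k![p∸k]!≡p!) (m∣m*n (p-1 !))
... | inj₁ p∣pCk = p∣pCk
... | inj₂ p∣k!*[p∸k]! with euclidsLemma (k !) ((p ∸ k) !) p-prime p∣k!*[p∸k]!
...   | inj₁ p∣k!     = ⊥-elim (prime∤! p-prime k<p p∣k!)
...   | inj₂ p∣[p∸k]! = ⊥-elim (prime∤! p-prime (ℕ.∸-monoʳ-< 0<k (ℕ.<⇒≤ k<p)) p∣[p∸k]!)

data Residue3 : ℕ → Set where
  0+3* : ∀ a → Residue3 (a ℕ.* 3)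
  1+3* : ∀ a → Residue3 (1 ℕ.+ a ℕ.* 3)
  2+3* : ∀ a → Residue3 (2 ℕ.+ a ℕ.* 3)

residue3 : ∀ n → Residue3 n
residue3 zero = 0+3* 0
residue3 (suc n) with residue3 n
... | 0+3* a = 1+3* a
... | 1+3* a = 2+3* a
... | 2+3* a = 0+3* (suc a)

3∣[2+3t]²∸1 : ∀ t → 3 ∣ (2 ℕ.+ t ℕ.* 3) ℕ.^ 2 ∸ 1
3∣[2+3t]²∸1 t = divides ((t ℕ.* 3 ℕ.+ 1) ℕ.* (t ℕ.+ 1)) (≡.cong (_∸ 1) (eq t))
  where
  eq : ∀ t → (2 ℕ.+ t ℕ.* 3) ℕ.* ((2 ℕ.+ t ℕ.* 3) ℕ.* 1) ≡ 1 ℕ.+ (t ℕ.* 3 ℕ.+ 1) ℕ.* (t ℕ.+ 1) ℕ.* 3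
  eq = solve-∀

3∣1+[2+3a][1+3t] : ∀ t a → 3 ∣ suc ((2 ℕ.+ a ℕ.* 3) ℕ.* suc (t ℕ.* 3))
3∣1+[2+3a][1+3t] t a = divides (1 ℕ.+ 2 ℕ.* t ℕ.+ a ℕ.+ 3 ℕ.* a ℕ.* t) (eq t a)
  where
  eq : ∀ t a → 1 ℕ.+ (2 ℕ.+ a ℕ.* 3) ℕ.* (1 ℕ.+ t ℕ.* 3) ≡ (1 ℕ.+ 2 ℕ.* t ℕ.+ a ℕ.+ 3 ℕ.* a ℕ.* t) ℕ.* 3
  eq = solve-∀

3∣3t+3a[1+3t] : ∀ t a → 3 ∣ t ℕ.* 3 ℕ.+ a ℕ.* 3 ℕ.* suc (t ℕ.* 3)
3∣3t+3a[1+3t] t a = divides (t ℕ.+ a ℕ.* (1 ℕ.+ t ℕ.* 3)) (eq t a)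
  where
  eq : ∀ t a → t ℕ.* 3 ℕ.+ a ℕ.* 3 ℕ.* (1 ℕ.+ t ℕ.* 3) ≡ (t ℕ.+ a ℕ.* (1 ℕ.+ t ℕ.* 3)) ℕ.* 3
  eq = solve-∀

-- exponent q′ k is the paper's s = 1 + k (q − 1), with q′ = q − 1.
exponent : ℕ → ℤ → ℤ
exponent q′ k = + 1 +ℤ k *ℤ + q′

exponent-+ : ∀ q′ k → exponent (suc q′) (+ k) ≡ + suc (k ℕ.* suc q′)
exponent-+ q′ zero    = ≡.refl
exponent-+ q′ (suc k) = ≡.refl

exponent-[1+] : ∀ q′ k → exponent (suc q′) -[1+ k ] ≡ ℤ.- + (q′ ℕ.+ k ℕ.* suc q′)
exponent-[1+] q′ k = 1+-[1+N]≡-N (q′ ℕ.+ k ℕ.* suc q′)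
  where
  1+-[1+N]≡-N : ∀ N → + 1 +ℤ -[1+ N ] ≡ ℤ.- + N
  1+-[1+N]≡-N zero    = ≡.refl
  1+-[1+N]≡-N (suc N) = ≡.refl

module _ {c ℓ} (R : CommutativeRing c ℓ) where
  open CommutativeRing R
  open import Algebra.Properties.CommutativeSemiring.Exp commutativeSemiring
  open import Algebra.Properties.CommutativeSemiring.Binomial commutativeSemiring
    using (theorem; binomialTerm)
  open import Algebra.Properties.Semiring.Mult semiring
    using (_×_; ×-congʳ; ×-assocˡ; ×-assoc-*; ×-homo-1)
  open import Algebra.Properties.Semiring.Sum semiring
    using (sum; sum-init-last; sum-cong-≋; sum-replicate-zero)
  open import Algebra.Properties.Ring ring using (+-inverseˡ-unique)
  open import Relation.Binary.Reasoning.Setoid setoid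

  Additive : ℕ → Set (c ⊔ ℓ)
  Additive q = ∀ a b → (a + b) ^ q ≈ a ^ q + b ^ q

  1#^n≈1# : ∀ n → 1# ^ n ≈ 1#
  1#^n≈1# zero    = refl
  1#^n≈1# (suc n) = trans (*-identityˡ _) (1#^n≈1# n)

  n×0#≈0# : ∀ n → n × 0# ≈ 0#
  n×0#≈0# zero    = refl
  n×0#≈0# (suc n) = trans (+-identityˡ _) (n×0#≈0# n)

  ∣∧×1#≈0#⇒×≈0# : ∀ {d n} → d ∣ n → d × 1# ≈ 0# → ∀ a → n × a ≈ 0#
  ∣∧×1#≈0#⇒×≈0# {d} (divides q ≡.refl) d×1≈0 a = begin
    (q ℕ.* d) × a       ≈⟨ ×-assocˡ a q d ⟨
    q × (d × a)         ≈⟨ ×-congʳ q (×-congʳ d (*-identityˡ a)) ⟨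
    q × (d × (1# * a))  ≈⟨ ×-congʳ q (×-assoc-* d 1# a) ⟨
    q × ((d × 1#) * a)  ≈⟨ ×-congʳ q (trans (*-congʳ d×1≈0) (zeroˡ a)) ⟩
    q × 0#              ≈⟨ n×0#≈0# q ⟩
    0#                  ∎

  binomialTerm-first : ∀ a b n → binomialTerm a b n Fin.zero ≈ b ^ n
  binomialTerm-first a b n = trans (×-homo-1 _) (*-identityˡ _)

  binomialTerm-last : ∀ a b n → binomialTerm a b n (fromℕ n) ≈ a ^ n
  binomialTerm-last a b n rewrite toℕ-fromℕ n | nCn≡1 n | ℕ.n∸n≡0 n =
    trans (×-homo-1 _) (*-identityʳ _)

  frobenius : ∀ {p} → Prime p → p × 1# ≈ 0# → Additive p
  frobenius {zero}      p-prime = ⊥-elim (¬prime[0] p-prime)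
  frobenius {p@(suc r)} p-prime p×1≈0 a b = begin
    (a + b) ^ p                                    ≈⟨ theorem p a b ⟩
    term Fin.zero + sum (λ i → term (Fin.suc i))  ≈⟨ +-congˡ (sum-init-last (λ i → term (Fin.suc i))) ⟩
    term Fin.zero + (sum middle + term (fromℕ p))  ≈⟨ +-cong (binomialTerm-first a b p)
                                                              (+-cong middle≈0 (binomialTerm-last a b p)) ⟩
    b ^ p + (0# + a ^ p)                           ≈⟨ +-congˡ (+-identityˡ _) ⟩
    b ^ p + a ^ p                                  ≈⟨ +-comm _ _ ⟩
    a ^ p + b ^ p                                  ∎
    where
    term : Fin (suc p) → Carrier
    term = binomialTerm a b p
    middle : Fin r → Carrier
    middle i = term (Fin.suc (inject₁ i))
    middle≈0 : sum middle ≈ 0#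
    middle≈0 = trans (sum-cong-≋ λ i → ∣∧×1#≈0#⇒×≈0# (p∣pCk p-prime (s≤s z≤n) (s≤s (inject₁ℕ< i))) p×1≈0 _)
                     (sum-replicate-zero r)

  additive-* : ∀ {m n} → Additive m → Additive n → Additive (m ℕ.* n)
  additive-* {m} {n} additive-m additive-n a b = begin
    (a + b) ^ (m ℕ.* n)            ≈⟨ ^-assocʳ (a + b) m n ⟨
    ((a + b) ^ m) ^ n              ≈⟨ ^-congˡ n (additive-m a b) ⟩
    (a ^ m + b ^ m) ^ n            ≈⟨ additive-n (a ^ m) (b ^ m) ⟩
    (a ^ m) ^ n + (b ^ m) ^ n      ≈⟨ +-cong (^-assocʳ a m n) (^-assocʳ b m n) ⟩
    a ^ (m ℕ.* n) + b ^ (m ℕ.* n)  ∎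

  additive-^ : ∀ {p} → Additive p → ∀ n → Additive (p ℕ.^ n)
  additive-^ _ zero a b = trans (*-identityʳ _) (sym (+-cong (*-identityʳ a) (*-identityʳ b)))
  additive-^ {p} additive-p (suc n) = additive-* {p} {p ℕ.^ n} additive-p (additive-^ additive-p n)

  additive⇒^-homo-‿ : ∀ {q} → Additive (suc q) → ∀ b → (- b) ^ suc q ≈ - (b ^ suc q)
  additive⇒^-homo-‿ {q} additive b = +-inverseˡ-unique _ _ (begin
    (- b) ^ suc q + b ^ suc q  ≈⟨ additive (- b) b ⟨
    (- b + b) ^ suc q          ≈⟨ ^-congˡ (suc q) (-‿inverseˡ b) ⟩
    0# ^ suc q                 ≈⟨ zeroˡ _ ⟩
    0#                         ∎)

module _ {c ℓ m} (F : FiniteField c ℓ m) where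
  open FiniteField F
  open import Algebra.Properties.Semiring.Mult semiring using (_×_; ×1-homo-*; ×-homo-1)
  open import Algebra.Properties.Semiring.Sum semiring
    using (sum; sum-permute; ∑-distrib-+; sum-replicate; sum-cong-≋)
  open import Algebra.Properties.Ring ring
    using (+-identityˡ-unique; \\-leftDividesˡ; \\-leftDividesʳ)
  open import Relation.Binary.Reasoning.Setoid setoid

  index : Carrier → Fin m
  index a = proj₁ (enum-sur a)

  enum-index : ∀ a → enum (index a) ≈ a
  enum-index a = proj₂ (enum-sur a)

  _≟_ : Decidable _≈_
  a ≟ b with index a Fin.≟ index b
  ... | yes i≡j = yes (trans (sym (enum-index a)) (trans (reflexive (≡.cong enum i≡j)) (enum-index b)))
  ... | no  i≢j = no λ a≈b → i≢j (enum-inj _ _ (trans (enum-index a) (trans a≈b (sym (enum-index b)))))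

  translate : Carrier → Permutation m m
  translate c = permutation (λ i → index (c + enum i)) (λ i → index (- c + enum i))
    (λ i → enum-inj _ _ (trans (enum-index _) (trans (+-congˡ (enum-index _)) (\\-leftDividesˡ c (enum i)))))
    (λ i → enum-inj _ _ (trans (enum-index _) (trans (+-congˡ (enum-index _)) (\\-leftDividesʳ c (enum i)))))

  -- Translation by 1 permutes the elements, so their sum S satisfies S ≈ m × 1# + S.
  size×1#≈0# : m × 1# ≈ 0#
  size×1#≈0# = +-identityˡ-unique (m × 1#) (sum enum) (begin
    m × 1# + sum enum                       ≈⟨ +-congʳ (sum-replicate m) ⟨
    sum {m} (λ _ → 1#) + sum enum           ≈⟨ ∑-distrib-+ (λ _ → 1#) enum ⟨
    sum (λ i → 1# + enum i)                 ≈⟨ sum-cong-≋ (λ i → enum-index (1# + enum i)) ⟨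
    sum (λ i → enum (index (1# + enum i)))  ≈⟨ sum-permute enum (translate 1#) ⟨
    sum enum                                ∎)

  *-cancelˡ-≈0# : ∀ {a b} → ¬ a ≈ 0# → a * b ≈ 0# → b ≈ 0#
  *-cancelˡ-≈0# {a} {b} a≉0 ab≈0 = begin
    b               ≈⟨ *-identityˡ b ⟨
    1# * b          ≈⟨ *-congʳ (trans (*-comm (a ⁻¹) a) (inverseʳ a a≉0)) ⟨
    (a ⁻¹ * a) * b  ≈⟨ *-assoc (a ⁻¹) a b ⟩
    a ⁻¹ * (a * b)  ≈⟨ *-congˡ ab≈0 ⟩
    a ⁻¹ * 0#       ≈⟨ zeroʳ (a ⁻¹) ⟩
    0#              ∎

  ^≉0# : ∀ {a} → ¬ a ≈ 0# → ∀ n → ¬ a ^ n ≈ 0#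
  ^≉0# a≉0 zero    1≈0     = 0≉1 (sym 1≈0)
  ^≉0# a≉0 (suc n) a^1+n≈0 = ^≉0# a≉0 n (*-cancelˡ-≈0# a≉0 a^1+n≈0)

  ^≈0#⇒≈0# : ∀ {a} n → a ^ n ≈ 0# → a ≈ 0#
  ^≈0#⇒≈0# {a} n a^n≈0 with a ≟ 0#
  ... | yes a≈0 = a≈0
  ... | no  a≉0 = ⊥-elim (^≉0# a≉0 n a^n≈0)

  ×1#-homo-^ : ∀ p j → (p ℕ.^ j) × 1# ≈ (p × 1#) ^ j
  ×1#-homo-^ p zero    = ×-homo-1 1#
  ×1#-homo-^ p (suc j) = trans (×1-homo-* p (p ℕ.^ j)) (*-congˡ (×1#-homo-^ p j))

  size≡p^j⇒p×1#≈0# : ∀ {p j} → m ≡ p ℕ.^ j → p × 1# ≈ 0#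
  size≡p^j⇒p×1#≈0# {p} {j} ≡.refl = ^≈0#⇒≈0# j (trans (sym (×1#-homo-^ p j)) size×1#≈0#)

module _ {c ℓ m} (L : FiniteField c ℓ m) where
  open FiniteField L
  open import Algebra.Properties.CommutativeSemiring.Exp commutativeSemiring
    using (^-congˡ; ^-congʳ; ^-assocʳ; ^-homo-*; ^-distrib-*)
  open import Algebra.Properties.Ring ring using (⁻¹-anti-homo‿-)
  open import Algebra.Properties.CommutativeSemigroup *-commutativeSemigroup using (x∙yz≈y∙xz)
  open import Relation.Binary.Reasoning.Setoid setoid

  Tr-cong : ∀ q {u v} → u ≈ v → Tr L q u ≈ Tr L q v
  Tr-cong q u≈v = +-cong u≈v (^-congˡ q u≈v)

  Tr-≈0# : ∀ q {u} → u ≈ 0# → Tr L (suc q) u ≈ 0#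
  Tr-≈0# q u≈0 = trans (Tr-cong (suc q) u≈0) (trans (+-identityˡ _) (zeroˡ _))

  Tr[xy-x]≈0# : ∀ {q x y} → Additive commRing (suc q) →
                x ^ suc q ≈ x * y → y ^ suc q ≈ y * y → y ^ 3 ≈ 1# →
                Tr L (suc q) (x * y - x) ≈ 0#
  Tr[xy-x]≈0# {q} {x} {y} additive x^q≈xy y^q≈yy y³≈1 = begin
    (x * y - x) + (x * y - x) ^ suc q                ≈⟨ +-congˡ (additive (x * y) (- x)) ⟩
    (x * y - x) + ((x * y) ^ suc q + (- x) ^ suc q)  ≈⟨ +-congˡ (+-cong [xy]^q≈x (additive⇒^-homo-‿ commRing {q} additive x)) ⟩
    (x * y - x) + (x - x ^ suc q)                    ≈⟨ +-congˡ (+-congˡ (-‿cong x^q≈xy)) ⟩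
    (x * y - x) + (x - x * y)                        ≈⟨ +-congˡ (⁻¹-anti-homo‿- (x * y) x) ⟨
    (x * y - x) - (x * y - x)                        ≈⟨ -‿inverseʳ _ ⟩
    0#                                               ∎
    where
    [xy]^q≈x : (x * y) ^ suc q ≈ x
    [xy]^q≈x = begin
      (x * y) ^ suc q        ≈⟨ ^-distrib-* x y (suc q) ⟩
      x ^ suc q * y ^ suc q  ≈⟨ *-cong x^q≈xy y^q≈yy ⟩
      (x * y) * (y * y)      ≈⟨ *-assoc x y (y * y) ⟩
      x * (y * (y * y))      ≈⟨ *-congˡ (*-congˡ (*-congˡ (*-identityʳ y))) ⟨
      x * y ^ 3              ≈⟨ *-congˡ y³≈1 ⟩
      x * 1#                 ≈⟨ *-identityʳ x ⟩
      x                      ∎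

  ^ℤ-neg*^≈1# : ∀ {x} → ¬ x ≈ 0# → ∀ N → x ^ℤ (ℤ.- + N) * x ^ N ≈ 1#
  ^ℤ-neg*^≈1# x≉0 zero = *-identityˡ 1#
  ^ℤ-neg*^≈1# {x} x≉0 N@(suc _) = begin
    (x ⁻¹) ^ N * x ^ N  ≈⟨ ^-distrib-* (x ⁻¹) x N ⟨
    (x ⁻¹ * x) ^ N      ≈⟨ ^-congˡ N (trans (*-comm (x ⁻¹) x) (inverseʳ x x≉0)) ⟩
    1# ^ N              ≈⟨ 1#^n≈1# commRing N ⟩
    1#                  ∎

  module _ {y} (y³≈1 : y ^ 3 ≈ 1#) where
    y^[3a]≈1 : ∀ a → y ^ (a ℕ.* 3) ≈ 1#
    y^[3a]≈1 a = begin
      y ^ (a ℕ.* 3)  ≈⟨ ^-congʳ y (ℕ.*-comm a 3) ⟩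
      y ^ (3 ℕ.* a)  ≈⟨ ^-assocʳ y 3 a ⟨
      (y ^ 3) ^ a    ≈⟨ ^-congˡ a y³≈1 ⟩
      1# ^ a         ≈⟨ 1#^n≈1# commRing a ⟩
      1#             ∎

    y^[r+3a]≈y^r : ∀ r a → y ^ (r ℕ.+ a ℕ.* 3) ≈ y ^ r
    y^[r+3a]≈y^r r a = trans (^-homo-* y r (a ℕ.* 3)) (trans (*-congˡ (y^[3a]≈1 a)) (*-identityʳ _))

  module _ {t} (additive : Additive commRing (2 ℕ.+ t ℕ.* 3))
           {x} (x^[3q′]≈1 : x ^ (3 ℕ.* suc (t ℕ.* 3)) ≈ 1#) where
    private
      q′ : ℕ
      q′ = suc (t ℕ.* 3)
      y : Carrier
      y = x ^ q′

    x≉0 : ¬ x ≈ 0#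
    x≉0 x≈0 = 0≉1 (trans (sym (trans (^-congˡ (3 ℕ.* q′) x≈0) (zeroˡ _))) x^[3q′]≈1)

    y³≈1 : y ^ 3 ≈ 1#
    y³≈1 = trans (^-assocʳ x q′ 3) (trans (^-congʳ x (ℕ.*-comm q′ 3)) x^[3q′]≈1)

    y^q≈yy : y ^ (2 ℕ.+ t ℕ.* 3) ≈ y * y
    y^q≈yy = trans (y^[r+3a]≈y^r y³≈1 2 t) (*-congˡ (*-identityʳ y))

    x^[kq′]≈y^k : ∀ k → x ^ (k ℕ.* q′) ≈ y ^ k
    x^[kq′]≈y^k k = trans (^-congʳ x (ℕ.*-comm k q′)) (sym (^-assocʳ x q′ k))

    x^[1+kq′]≈x⊎xy : ∀ k → ¬ 3 ∣ suc (k ℕ.* q′) →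
                     x ^ suc (k ℕ.* q′) ≈ x ⊎ x ^ suc (k ℕ.* q′) ≈ x * y
    x^[1+kq′]≈x⊎xy k 3∤ with residue3 k
    ... | 0+3* a = inj₁ (trans (*-congˡ (trans (x^[kq′]≈y^k (a ℕ.* 3)) (y^[3a]≈1 y³≈1 a))) (*-identityʳ x))
    ... | 1+3* a = inj₂ (*-congˡ (trans (x^[kq′]≈y^k (1 ℕ.+ a ℕ.* 3))
                                        (trans (y^[r+3a]≈y^r y³≈1 1 a) (*-identityʳ y))))
    ... | 2+3* a = ⊥-elim (3∤ (3∣1+[2+3a][1+3t] t a))

    module _ (k : ℕ) where
      private
        N : ℕ
        N = t ℕ.* 3 ℕ.+ k ℕ.* q′
        w : Carrier
        w = x ^ℤ (ℤ.- + N)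

      -- x ^ ((1 + k) q′) is x * x ^ N by definition, as 1 + N = (1 + k) q′.
      w*y^[1+k]≈x : w * y ^ suc k ≈ x
      w*y^[1+k]≈x = begin
        w * y ^ suc k    ≈⟨ *-congˡ (x^[kq′]≈y^k (suc k)) ⟨
        w * (x * x ^ N)  ≈⟨ x∙yz≈y∙xz w x (x ^ N) ⟩
        x * (w * x ^ N)  ≈⟨ *-congˡ (^ℤ-neg*^≈1# x≉0 N) ⟩
        x * 1#           ≈⟨ *-identityʳ x ⟩
        x                ∎

      x^-N≈x⊎xy : ¬ 3 ∣ N → w ≈ x ⊎ w ≈ x * y
      x^-N≈x⊎xy 3∤ with residue3 k
      ... | 0+3* a = ⊥-elim (3∤ (3∣3t+3a[1+3t] t a))
      ... | 1+3* a = inj₂ (begin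
        w                ≈⟨ *-identityʳ w ⟨
        w * 1#           ≈⟨ *-congˡ y³≈1 ⟨
        w * (y * y ^ 2)  ≈⟨ x∙yz≈y∙xz w y (y ^ 2) ⟩
        y * (w * y ^ 2)  ≈⟨ *-congˡ (trans (sym (*-congˡ (y^[r+3a]≈y^r y³≈1 2 a))) w*y^[1+k]≈x) ⟩
        y * x            ≈⟨ *-comm y x ⟩
        x * y            ∎)
      ... | 2+3* a = inj₁ (trans (sym (*-identityʳ w))
                                 (trans (*-congˡ (sym (y^[3a]≈1 y³≈1 (suc a)))) w*y^[1+k]≈x))

    x^exponent≈x⊎xy : ∀ k → ¬ 3 ∣ ∣ exponent q′ k ∣ →
                      x ^ℤ exponent q′ k ≈ x ⊎ x ^ℤ exponent q′ k ≈ x * y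
    x^exponent≈x⊎xy (+ k) rewrite exponent-+ (t ℕ.* 3) k = x^[1+kq′]≈x⊎xy k
    x^exponent≈x⊎xy -[1+ k ] rewrite exponent-[1+] (t ℕ.* 3) k =
      λ 3∤ → x^-N≈x⊎xy k (λ 3∣N → 3∤ (≡.subst (3 ∣_) (≡.sym (∣-i∣≡∣i∣ (+ _))) 3∣N))

    Tr[x^exponent-x]≈0# : ∀ k → gcd ∣ exponent q′ k ∣ ((2 ℕ.+ t ℕ.* 3) ℕ.^ 2 ∸ 1) ≡ 1 →
                          Tr L (2 ℕ.+ t ℕ.* 3) (x ^ℤ exponent q′ k - x) ≈ 0#
    Tr[x^exponent-x]≈0# k gcd≡1 with x^exponent≈x⊎xy k 3∤s
      where
      3∤s : ¬ 3 ∣ ∣ exponent q′ k ∣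
      3∤s 3∣s with ∣1⇒≡1 (≡.subst (3 ∣_) gcd≡1 (gcd-greatest 3∣s (3∣[2+3t]²∸1 t)))
      ... | ()
    ... | inj₁ x^s≈x  = Tr-≈0# q′ (trans (+-congʳ x^s≈x) (-‿inverseʳ x))
    ... | inj₂ x^s≈xy = trans (Tr-cong (suc q′) (+-congʳ x^s≈xy))
                              (Tr[xy-x]≈0# {q′} additive refl y^q≈yy y³≈1)

  Tr[x^s-x]≈0# : ∀ {q t} → q ≡ 2 ℕ.+ t ℕ.* 3 → Additive commRing q →
                 ∀ k → gcd ∣ exponent (q ∸ 1) k ∣ (q ℕ.^ 2 ∸ 1) ≡ 1 →
                 ∀ x → x ^ (3 ℕ.* (q ∸ 1)) ≈ 1# → Tr L q (x ^ℤ exponent (q ∸ 1) k - x) ≈ 0#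
  Tr[x^s-x]≈0# {t = t} ≡.refl additive k gcd≡1 x x^[3[q-1]]≈1 =
    Tr[x^exponent-x]≈0# {t} additive x^[3[q-1]]≈1 k gcd≡1

open import Data.Nat using (_^_; _*_)

proposition3p5 :
    ∀ {c ℓ} (p n : ℕ) → Prime p → p % 2 ≡ 1 → (p ^ n) % 3 ≡ 2 →
      (L : FiniteField c ℓ ((p ^ n) ^ 2)) →
      (k : ℤ) →
      gcd ∣ (ℤ+ 1) +ℤ (k *ℤ (ℤ+ (p ^ n ∸ 1))) ∣ ((p ^ n) ^ 2 ∸ 1) ≡ 1 →
      (x : FiniteField.Carrier L) →
      FiniteField._≈_ L (FiniteField._^_ L x (3 * (p ^ n ∸ 1))) (FiniteField.1# L) →
      FiniteField._≈_ L
        (Tr L (p ^ n)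
          (FiniteField._-_ L (FiniteField._^ℤ_ L x ((ℤ+ 1) +ℤ (k *ℤ (ℤ+ (p ^ n ∸ 1))))) x))
        (FiniteField.0# L)
proposition3p5 p n p-prime _ p^n%3≡2 L =
  Tr[x^s-x]≈0# L {t = p ^ n ℕ./ 3} p^n≡2+3t (additive-^ commRing frobenius-p n)
  where
  open FiniteField L using (commRing)
  p^n≡2+3t : p ^ n ≡ 2 ℕ.+ (p ^ n ℕ./ 3) * 3
  p^n≡2+3t = ≡.trans (m≡m%n+[m/n]*n (p ^ n) 3) (≡.cong (ℕ._+ (p ^ n ℕ./ 3) * 3) p^n%3≡2)
  frobenius-p : Additive commRing p
  frobenius-p = frobenius commRing p-prime (size≡p^j⇒p×1#≈0# L {p} {n * 2} (ℕ.^-*-assoc p n 2))
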